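{- Let $n,t\in\mathbb N$ with $t<n$, let $F$ be chosen uniformly at random from $\mathcal F(n,t)$, and let $\mathbf D=(d_F(1),\dots,d_F(n))$ be its degree sequence. Throw $n-t-1$ balls independently and uniformly at random into $n$ bins and let $Z_j$ be the load of the $j$-th bin. Independently, let $R$ be uniform on $[t]$ and for $j\in[t]$ set $X_j=1$ if $R=j$ and $X_j=0$ otherwise. Then $$(Z_1+X_1,\dots,Z_t+X_t,Z_{t+1}+1,\dots,Z_n+1)$$ has the same distribution as $\mathbf D$.
   Context: $\mathcal F(n,t)$ is the class of forests on vertex set $[n]$ with exactly $t$ tree components (isolated vertices allowed) such that the vertices $1,\dots,t$ lie in pairwise different components; $d_F(v)$ is the degree of $v$ in $F$. -}

module Defs where

open import Data.Nat using (ℕ; zero; suc; _+_; _<_; _≤_; _<ᵇ_; _≡ᵇ_)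
open import Data.Bool using (Bool; true; false; if_then_else_)
open import Data.Fin using (Fin; toℕ; _≟_)
open import Data.Vec using (Vec; lookup; tabulate; toList)
open import Data.List using (List; []; _∷_; length; filterᵇ; _∷ʳ_)
open import Data.List.Relation.Unary.Unique.Propositional using (Unique)
open import Data.List.Relation.Unary.Linked using (Linked)
open import Data.List.Membership.Propositional using (_∈_)
open import Data.Product using (Σ; _×_; ∃)
open import Function using (id)
open import Function.Bundles using (_⇔_)
open import Function.Definitions using (Surjective)
open import Relation.Binary.PropositionalEquality using (_≡_; _≢_)
open import Relation.Nullary using (¬_)
open import Relation.Nullary.Decidable using (⌊_⌋)

HasCount : {A : Set} → (A → Set) → ℕ → Set
HasCount {A} P k =
  Σ (List A) λ xs → (length xs ≡ k) × Unique xs × (∀ a → P a ⇔ (a ∈ xs))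

-- A (labelled) graph on vertex set Fin n (vertex i : Fin n is vertex toℕ i + 1
-- of the paper), given by its adjacency matrix.
Graph : ℕ → Set
Graph n = Vec (Vec Bool n) n

adj : ∀ {n} → Graph n → Fin n → Fin n → Bool
adj G u v = lookup (lookup G u) v

Adj : ∀ {n} → Graph n → Fin n → Fin n → Set
Adj G u v = adj G u v ≡ true

IsSimple : ∀ {n} → Graph n → Set
IsSimple {n} G = (∀ u v → adj G u v ≡ adj G v u) × (∀ u → adj G u u ≡ false)

data Walk {n} (G : Graph n) : Fin n → Fin n → Set where
  here : ∀ {u} → Walk G u u
  step : ∀ {u v w} → Adj G u v → Walk G v w → Walk G u w

Connected : ∀ {n} → Graph n → Fin n → Fin n → Set
Connected G u v = Walk G u v

HasCycle : ∀ {n} → Graph n → Set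
HasCycle {n} G =
  Σ (Fin n) λ v → Σ (List (Fin n)) λ ws →
    (2 ≤ length ws) × Unique (v ∷ ws) × Linked (Adj G) ((v ∷ ws) ∷ʳ v)

IsForest : ∀ {n} → Graph n → Set
IsForest G = IsSimple G × ¬ HasCycle G

-- G has exactly t connected components: the set of components is in
-- bijection with Fin t (a surjective map whose fibres are the components).
HasComponents : ∀ {n} → Graph n → ℕ → Set
HasComponents {n} G t =
  Σ (Fin n → Fin t) λ c → Surjective _≡_ _≡_ c × (∀ u v → (c u ≡ c v) ⇔ Connected G u v)

-- membership in 𝓕(n,t): forest with exactly t components, vertices 1..t
-- (i.e. Fin-indices 0..t-1) in pairwise different components
InF : (n t : ℕ) → Graph n → Set
InF n t G = IsForest G × HasComponents G t
  × (∀ u v → toℕ u < t → toℕ v < t → u ≢ v → ¬ Connected G u v)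

count : ∀ {A : Set} → (A → Bool) → List A → ℕ
count p xs = length (filterᵇ p xs)

deg : ∀ {n} → Graph n → Fin n → ℕ
deg G v = count id (toList (lookup G v))

degSeq : ∀ {n} → Graph n → Vec ℕ n
degSeq G = tabulate (deg G)

-- balls: bs lists the bin of each of the m balls; load of bin j
load : ∀ {m n} → Vec (Fin n) m → Fin n → ℕ
load bs j = count (λ x → ⌊ x ≟ j ⌋) (toList bs)

-- (Z_1+X_1,…,Z_t+X_t,Z_{t+1}+1,…,Z_n+1) with X_j = [R = j]
ballVec : ∀ {m n t} → Vec (Fin n) m → Fin t → Vec ℕ n
ballVec {t = t} bs r = tabulate λ j →
  if toℕ j <ᵇ t
  then load bs j + (if toℕ r ≡ᵇ toℕ j then 1 else 0)
  else load bs j + 1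

{-# OPTIONS --safe #-}
-- A forest in 𝓕(n,t) is the same as a forest rooted at the vertices 1,…,t: every
-- component contains exactly one of them. Such forests are coded Prüfer-style by
-- repeatedly deleting the least non-root leaf, recording its neighbour, and declaring
-- the deleted (now isolated) vertex a root. This gives a bijection with the words
-- w ∈ [n]^(n-t) whose last letter is a root, under which deg j is the number of
-- occurrences of j in w plus [j is not a root]. Writing w = c r with c ∈ [n]^(n-t-1)
-- and r ∈ [t], that degree sequence is exactly ballVec c r. Hence |𝓕(n,t)| = n^(n-t-1) t,
-- and the forests with degree sequence d correspond to the (c, r) with ballVec c r = d.
module Submission where

open import Defs
open import Data.Nat using (ℕ; zero; suc; _+_; _*_; _^_; _∸_; _≤_; _<_; s≤s; z≤n; _<ᵇ_; _≡ᵇ_)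
open import Data.Nat.Properties as ℕ using (≤-antisym; ≤-trans; +-comm; +-assoc; +-identityʳ; suc-injective)
open import Algebra.Properties.CommutativeSemigroup ℕ.+-commutativeSemigroup using (interchange)
open import Data.Bool using (Bool; true; false; if_then_else_; _∧_; _∨_; not; T)
import Data.Bool.Properties as Bool
open import Data.Fin using (Fin; zero; suc; toℕ; _≟_; combine; funToFin; finToFun; punchOut; inject≤; fromℕ<; cast; _↑ʳ_)
import Data.Fin.Properties as Fin
open import Data.Vec as Vec using (Vec; []; _∷_; lookup; tabulate; toList; init; last; initLast)
open import Data.Vec.Properties using (lookup∘tabulate; tabulate∘lookup; tabulate-cong; length-toList; init-∷ʳ; last-∷ʳ)
open import Data.List as List using (List; []; _∷_; length; map; allFin; _++_; _∷ʳ_)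
open import Data.List.Properties using (length-map; map-∘; map-id-local; length-tabulate; ++-assoc; length-removeAt′)
open import Data.List.Relation.Unary.Any using (here; there; any?)
open import Data.List.Relation.Unary.All as All using (All; []; _∷_)
open import Data.List.Relation.Unary.All.Properties using (++⁺; ++⁻ˡ; ¬Any⇒All¬; anti-mono)
open import Data.List.Relation.Unary.Linked as Linked using (Linked; []; [-]; _∷_)
open import Data.List.Relation.Unary.Unique.Propositional using (Unique; []; _∷_)
open import Data.List.Relation.Unary.Unique.Propositional.Properties using (map⁻; allFin⁺; tabulate⁺)
open import Data.List.Membership.Propositional using (_∈_; _∉_; _─_)
open import Data.List.Membership.Propositional.Properties
  using (∈-map⁺; ∈-map⁻; ∈-allFin; ∈-++⁺ˡ; ∈-++⁺ʳ; ∈-∃++; ∈-tabulate⁺; ∈-tabulate⁻)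
open import Data.List.Relation.Binary.Subset.Propositional using (_⊆_)
open import Data.Product using (Σ; ∃; _×_; _,_; proj₁; proj₂)
open import Data.Sum using (_⊎_; inj₁; inj₂)
open import Data.Unit using (⊤; tt)
open import Data.Empty using (⊥-elim)
open import Function using (_∘_; id)
open import Function.Bundles using (_⇔_; mk⇔; Equivalence; _↔_; mk↔ₛ′; Inverse)
open import Function.Properties.Inverse using (↔-refl; ↔-sym; ↔-trans)
open import Data.Product.Function.NonDependent.Propositional using (_×-↔_)
open import Relation.Binary.PropositionalEquality
  using (_≡_; _≢_; refl; sym; trans; cong; cong₂; subst; module ≡-Reasoning)
open import Relation.Nullary using (¬_; yes; no)
open import Relation.Nullary.Decidable using (⌊_⌋; _×-dec_; ¬?; does-⇔; isYes≗does)

-- Counting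

module _ {A : Set} where

  ∈-─ : ∀ {x z : A} {ys} (p : x ∈ ys) → z ∈ ys → x ≢ z → z ∈ ys ─ p
  ∈-─ (here refl) (here refl) x≢z = ⊥-elim (x≢z refl)
  ∈-─ (here refl) (there z∈) x≢z = z∈
  ∈-─ (there p) (here refl) x≢z = here refl
  ∈-─ (there p) (there z∈) x≢z = there (∈-─ p z∈ x≢z)

  ─-⊆ : ∀ {x : A} {ys} (p : x ∈ ys) → ys ─ p ⊆ ys
  ─-⊆ (here _) z∈ = there z∈
  ─-⊆ (there p) (here refl) = here refl
  ─-⊆ (there p) (there z∈) = there (─-⊆ p z∈)

  Unique-─ : ∀ {x : A} {ys} (p : x ∈ ys) → Unique ys → Unique (ys ─ p)
  Unique-─ (here _) (_ ∷ u) = u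
  Unique-─ {ys = y ∷ _} (there p) (y∉ ∷ u) = anti-mono (─-⊆ p) y∉ ∷ Unique-─ p u

  ∉-─ : ∀ {x : A} {ys} (p : x ∈ ys) → Unique ys → x ∉ ys ─ p
  ∉-─ (here refl) (x∉ ∷ _) x∈ = All.lookup x∉ x∈ refl
  ∉-─ (there p) (y∉ ∷ _) (here refl) = All.lookup y∉ p refl
  ∉-─ (there p) (_ ∷ u) (there x∈) = ∉-─ p u x∈

  unique-⊆⇒length-≤ : ∀ {xs ys : List A} → Unique xs → xs ⊆ ys → length xs ≤ length ys
  unique-⊆⇒length-≤ {[]} _ _ = z≤n
  unique-⊆⇒length-≤ {x ∷ xs} {ys} (x∉xs ∷ u) xs⊆ys =
    ≤-trans (s≤s (unique-⊆⇒length-≤ u (λ z∈xs → ∈-─ x∈ys (xs⊆ys (there z∈xs)) (All.lookup x∉xs z∈xs))))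
            (ℕ.≤-reflexive (sym (length-removeAt′ ys _)))
    where
    x∈ys : x ∈ ys
    x∈ys = xs⊆ys (here refl)

module _ {A : Set} {P : A → Set} where

  HasCount-≤ : ∀ {k} → HasCount P k → (ys : List A) → (∀ {a} → P a → a ∈ ys) → k ≤ length ys
  HasCount-≤ (xs , refl , u , members) ys P⊆ys =
    unique-⊆⇒length-≤ u (λ a∈xs → P⊆ys (Equivalence.from (members _) a∈xs))

  HasCount-unique : ∀ {k l} → HasCount P k → HasCount P l → k ≡ l
  HasCount-unique hk@(xs , refl , _ , xs-members) hl@(ys , refl , _ , ys-members) =
    ≤-antisym (HasCount-≤ hk ys (Equivalence.to (ys-members _)))
              (HasCount-≤ hl xs (Equivalence.to (xs-members _)))

  HasCount-cong : ∀ {Q : A → Set} {k} → (∀ a → P a ⇔ Q a) → HasCount P k → HasCount Q k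
  HasCount-cong P⇔Q (xs , len , u , members) =
    xs , len , u , λ a → mk⇔ (Equivalence.to (members a) ∘ Equivalence.from (P⇔Q a))
                             (Equivalence.to (P⇔Q a) ∘ Equivalence.from (members a))

  HasCount-zero : HasCount P 0 → ∀ a → ¬ P a
  HasCount-zero ([] , _ , _ , members) a pa with () ← Equivalence.to (members a) pa

  HasCount-suc⇒inhabited : ∀ {k} → HasCount P (suc k) → ∃ P
  HasCount-suc⇒inhabited (x ∷ _ , _ , _ , members) = x , Equivalence.from (members x) (here refl)

  HasCount-remove : ∀ {k x} → HasCount P (suc k) → P x → HasCount (λ y → P y × y ≢ x) k
  HasCount-remove {x = x} (xs , len , u , members) px =
    xs ─ x∈ , suc-injective (trans (sym (length-removeAt′ xs _)) len) , Unique-─ x∈ u , λ y → mk⇔ into out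
    where
    x∈ : x ∈ xs
    x∈ = Equivalence.to (members x) px
    into : ∀ {y} → P y × y ≢ x → y ∈ xs ─ x∈
    into {y} (py , y≢x) = ∈-─ x∈ (Equivalence.to (members y) py) (y≢x ∘ sym)
    out : ∀ {y} → y ∈ xs ─ x∈ → P y × y ≢ x
    out {y} y∈ = Equivalence.from (members y) (─-⊆ x∈ y∈) , λ { refl → ∉-─ x∈ u y∈ }

record SubsetBijection {A B : Set} (P : A → Set) (Q : B → Set) : Set where
  field
    to : A → B
    from : B → A
    to-resp : ∀ {x} → P x → Q (to x)
    from-resp : ∀ {y} → Q y → P (from y)
    from∘to : ∀ {x} → P x → from (to x) ≡ x
    to∘from : ∀ {y} → Q y → to (from y) ≡ y

↔⇒SubsetBijection : ∀ {A B : Set} → A ↔ B → SubsetBijection {A} {B} (λ _ → ⊤) (λ _ → ⊤)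
↔⇒SubsetBijection A↔B = record
  { to = to ; from = from ; to-resp = id ; from-resp = id
  ; from∘to = λ _ → strictlyInverseʳ _ ; to∘from = λ _ → strictlyInverseˡ _ }
  where open Inverse A↔B

module _ {A B : Set} {P : A → Set} {Q : B → Set} (φ : SubsetBijection P Q) where
  open SubsetBijection φ

  HasCount-transport : ∀ {k} → HasCount P k → HasCount Q k
  HasCount-transport (xs , length-xs , unique-xs , xs-members) =
    map to xs , trans (length-map to xs) length-xs , unique-map , members
    where
    from∘to-on-xs : map from (map to xs) ≡ xs
    from∘to-on-xs = trans (sym (map-∘ xs))
      (map-id-local (All.tabulate (λ x∈xs → from∘to (Equivalence.from (xs-members _) x∈xs))))
    unique-map : Unique (map to xs)
    unique-map = map⁻ (subst Unique (sym from∘to-on-xs) unique-xs)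
    members : ∀ y → Q y ⇔ (y ∈ map to xs)
    members y = mk⇔
      (λ qy → subst (_∈ map to xs) (to∘from qy) (∈-map⁺ to (Equivalence.to (xs-members _) (from-resp qy))))
      (λ y∈ → let x , x∈xs , y≡tox = ∈-map⁻ to y∈ in
              subst Q (sym y≡tox) (to-resp (Equivalence.from (xs-members x) x∈xs)))

HasCount-empty : ∀ {A : Set} {P : A → Set} {k} → ¬ A → HasCount P k → k ≡ 0
HasCount-empty ¬A ([] , refl , _) = refl
HasCount-empty ¬A (x ∷ _ , _) = ⊥-elim (¬A x)

HasCount-Fin : ∀ N → HasCount (λ (_ : Fin N) → ⊤) N
HasCount-Fin N = allFin N , length-tabulate id , allFin⁺ N , λ i → mk⇔ (λ _ → ∈-allFin i) (λ _ → tt)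

module _ {n : ℕ} where

  funToFin-cong : ∀ {m} {f g : Fin m → Fin n} → (∀ i → f i ≡ g i) → funToFin f ≡ funToFin g
  funToFin-cong {zero} _ = refl
  funToFin-cong {suc m} f≗g = cong₂ combine (f≗g zero) (funToFin-cong (f≗g ∘ suc))

  Vec↔Fin^ : ∀ {m} → Vec (Fin n) m ↔ Fin (n ^ m)
  Vec↔Fin^ {m} = mk↔ₛ′ (funToFin ∘ lookup) (tabulate ∘ finToFun)
    (λ k → trans (funToFin-cong {m} (lookup∘tabulate (finToFun k))) (Fin.funToFin-finToFin {m} {n} k))
    (λ v → trans (tabulate-cong (Fin.finToFun-funToFin (lookup v))) (tabulate∘lookup v))

HasCount-Vec×Fin : ∀ n m t → HasCount (λ (_ : Vec (Fin n) m × Fin t) → ⊤) (n ^ m * t)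
HasCount-Vec×Fin n m t = HasCount-transport (↔⇒SubsetBijection codes↔Fin) (HasCount-Fin (n ^ m * t))
  where
  codes↔Fin : Fin (n ^ m * t) ↔ (Vec (Fin n) m × Fin t)
  codes↔Fin = ↔-trans Fin.*↔× (↔-sym Vec↔Fin^ ×-↔ ↔-refl)

Fin-injective⇒surjective : ∀ {k} (f : Fin k → Fin k) → (∀ {i j} → f i ≡ f j → i ≡ j)
  → ∀ y → Σ (Fin k) λ i → f i ≡ y
Fin-injective⇒surjective {suc k} f f-inj y with Fin.any? (λ i → f i ≟ y)
... | yes found = found
... | no missed = ⊥-elim (ℕ.<-irrefl refl (Fin.injective⇒≤ {f = squeeze} squeeze-injective))
  where
  y≢f : ∀ i → y ≢ f i
  y≢f i y≡fi = missed (i , sym y≡fi)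
  squeeze : Fin (suc k) → Fin k
  squeeze i = punchOut (y≢f i)
  squeeze-injective : ∀ {i j} → squeeze i ≡ squeeze j → i ≡ j
  squeeze-injective e = f-inj (Fin.punchOut-injective (y≢f _) (y≢f _) e)

module _ {A : Set} {R : A → A → Set} where

  Linked-restrict : ∀ {P : A → Set} {S : A → A → Set} → (∀ {a b} → P a → P b → R a b → S a b)
    → ∀ {xs} → All P xs → Linked R xs → Linked S xs
  Linked-restrict R⇒S _ [] = []
  Linked-restrict R⇒S _ [-] = [-]
  Linked-restrict R⇒S (pa ∷ pb ∷ ps) (r ∷ l) = R⇒S pa pb r ∷ Linked-restrict R⇒S (pb ∷ ps) l

  Linked-++⁻ˡ : ∀ xs {ys} → Linked R (xs ++ ys) → Linked R xs
  Linked-++⁻ˡ [] l = []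
  Linked-++⁻ˡ (x ∷ []) l = [-]
  Linked-++⁻ˡ (x ∷ y ∷ xs) (r ∷ l) = r ∷ Linked-++⁻ˡ (y ∷ xs) l

  Linked-∷ʳ : ∀ xs {z y} → Linked R (xs ∷ʳ z) → R z y → Linked R (xs ∷ʳ z ∷ʳ y)
  Linked-∷ʳ [] [-] r = r ∷ [-]
  Linked-∷ʳ (x ∷ []) (r₁ ∷ [-]) r = r₁ ∷ r ∷ [-]
  Linked-∷ʳ (x ∷ x₁ ∷ xs) (r₁ ∷ l) r = r₁ ∷ Linked-∷ʳ (x₁ ∷ xs) l r

  Linked-predecessor : ∀ x xs {v ys} → Linked R (x ∷ xs ++ v ∷ ys)
    → Σ A λ a → R a v × ((a ≡ x × xs ≡ []) ⊎ a ∈ xs)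
  Linked-predecessor x [] (r ∷ _) = x , r , inj₁ (refl , refl)
  Linked-predecessor x (y ∷ xs) (_ ∷ l) with Linked-predecessor y xs l
  ... | a , r , inj₁ (refl , refl) = a , r , inj₂ (here refl)
  ... | a , r , inj₂ a∈xs = a , r , inj₂ (there a∈xs)

  Linked-successor : ∀ xs {v y ys} → Linked R (xs ++ v ∷ y ∷ ys) → R v y
  Linked-successor [] (r ∷ _) = r
  Linked-successor (x ∷ []) (_ ∷ l) = Linked-successor [] l
  Linked-successor (x ∷ x₁ ∷ xs) (_ ∷ l) = Linked-successor (x₁ ∷ xs) l

module _ {A : Set} where

  Unique-++⁻ˡ : ∀ xs {ys : List A} → Unique (xs ++ ys) → Unique xs
  Unique-++⁻ˡ [] _ = []
  Unique-++⁻ˡ (x ∷ xs) (x∉ ∷ u) = ++⁻ˡ xs x∉ ∷ Unique-++⁻ˡ xs u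

  Unique-++⇒disjoint : ∀ xs {ys : List A} {a b} → Unique (xs ++ ys) → a ∈ xs → b ∈ ys → a ≢ b
  Unique-++⇒disjoint (x ∷ xs) (x∉ ∷ _) (here refl) b∈ys = All.lookup x∉ (∈-++⁺ʳ xs b∈ys)
  Unique-++⇒disjoint (x ∷ xs) (_ ∷ u) (there a∈xs) b∈ys = Unique-++⇒disjoint xs u a∈xs b∈ys

  cycle-neighbours : ∀ {R : A → A → Set} (c : A) (ws : List A) → 2 ≤ length ws
    → Unique (c ∷ ws) → Linked R ((c ∷ ws) ∷ʳ c) → ∀ {v} → v ∈ c ∷ ws
    → Σ A λ a → Σ A λ b → a ≢ b × R a v × R v b
  cycle-neighbours c (w₁ ∷ w₂ ∷ ws) _ (_ ∷ w₁∉ ∷ _) (r ∷ l) (here refl)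
    with Linked-predecessor w₁ (w₂ ∷ ws) l
  ... | a , ra , inj₂ a∈ = a , w₁ , (λ a≡w₁ → All.lookup w₁∉ a∈ (sym a≡w₁)) , ra , r
  cycle-neighbours c (_ ∷ []) (s≤s ()) _ _ (here refl)
  cycle-neighbours {R} c ws len u l {v} (there v∈ws) with ∈-∃++ v∈ws
  ... | p , q , refl = inner p q len u (subst (λ z → Linked R (c ∷ z)) (++-assoc p (v ∷ q) (c ∷ [])) l)
    where
    inner : ∀ p q → 2 ≤ length (p ++ v ∷ q) → Unique (c ∷ p ++ v ∷ q)
      → Linked R (c ∷ p ++ v ∷ q ++ c ∷ []) → Σ A λ a → Σ A λ b → a ≢ b × R a v × R v b
    inner p [] len u l with Linked-predecessor c p l
    ... | a , ra , inj₁ (refl , refl) = ⊥-elim (ℕ.<-irrefl refl len)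
    ... | a , ra , inj₂ a∈p =
      a , c , (λ a≡c → Unique-++⇒disjoint (c ∷ []) u (here refl) (∈-++⁺ˡ a∈p) (sym a≡c)) , ra ,
      Linked-successor (c ∷ p) l
    inner p (w ∷ q) len u l with Linked-predecessor c p l
    ... | a , ra , a-before-v =
      a , w , Unique-++⇒disjoint (c ∷ p) u (before a-before-v) (there (here refl)) , ra ,
      Linked-successor (c ∷ p) l
      where
      before : ∀ {a} → (a ≡ c × p ≡ []) ⊎ a ∈ p → a ∈ c ∷ p
      before (inj₁ (refl , _)) = here refl
      before (inj₂ a∈p) = there a∈p

true≢false : true ≢ false
true≢false ()

trues : ∀ {m} → (Fin m → Bool) → ℕ
trues {zero} f = 0
trues {suc m} f = (if f zero then 1 else 0) + trues (f ∘ suc)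

trues-cong : ∀ {m} {f g : Fin m → Bool} → (∀ j → f j ≡ g j) → trues f ≡ trues g
trues-cong {zero} _ = refl
trues-cong {suc m} {f} f≗g rewrite f≗g zero = cong (_ +_) (trues-cong (f≗g ∘ suc))

count-tabulate : ∀ {m} (f : Fin m → Bool) → count id (toList (tabulate f)) ≡ trues f
count-tabulate {zero} f = refl
count-tabulate {suc m} f with f zero
... | true = cong suc (count-tabulate (f ∘ suc))
... | false = count-tabulate (f ∘ suc)

trues≡0⇒false : ∀ {m} (f : Fin m → Bool) → trues f ≡ 0 → ∀ j → f j ≡ false
trues≡0⇒false {suc m} f e j with f zero in f0
trues≡0⇒false {suc m} f () j | true
trues≡0⇒false {suc m} f e zero | false = f0
trues≡0⇒false {suc m} f e (suc j) | false = trues≡0⇒false (f ∘ suc) e j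

false⇒trues≡0 : ∀ {m} (f : Fin m → Bool) → (∀ j → f j ≡ false) → trues f ≡ 0
false⇒trues≡0 {zero} f _ = refl
false⇒trues≡0 {suc m} f all-false rewrite all-false zero = false⇒trues≡0 (f ∘ suc) (all-false ∘ suc)

trues-unset : ∀ {m} (f g : Fin m → Bool) (p : Fin m) → f p ≡ true → g p ≡ false
  → (∀ k → k ≢ p → f k ≡ g k) → trues f ≡ suc (trues g)
trues-unset f g zero fp gp f≗g rewrite fp | gp = cong suc (trues-cong (λ k → f≗g (suc k) (λ ())))
trues-unset f g (suc p) fp gp f≗g rewrite f≗g zero (λ ()) with g zero
... | true = cong suc (trues-unset (f ∘ suc) (g ∘ suc) p fp gp (λ k k≢p → f≗g (suc k) (k≢p ∘ Fin.suc-injective)))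
... | false = trues-unset (f ∘ suc) (g ∘ suc) p fp gp (λ k k≢p → f≗g (suc k) (k≢p ∘ Fin.suc-injective))

unique-true⇒trues≡1 : ∀ {m} (f : Fin m → Bool) (p : Fin m) → f p ≡ true → (∀ k → f k ≡ true → k ≡ p)
  → trues f ≡ 1
unique-true⇒trues≡1 f zero fp only-p rewrite fp =
  cong suc (false⇒trues≡0 (f ∘ suc) (λ k → Bool.¬-not (λ fk → Fin.0≢1+n (sym (only-p (suc k) fk)))))
unique-true⇒trues≡1 f (suc p) fp only-p with f zero in f0
... | true = ⊥-elim (Fin.0≢1+n (only-p zero f0))
... | false = unique-true⇒trues≡1 (f ∘ suc) p fp (λ k fk → Fin.suc-injective (only-p (suc k) fk))

trues≡1⇒unique-true : ∀ {m} (f : Fin m → Bool) → trues f ≡ 1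
  → Σ (Fin m) λ p → f p ≡ true × (∀ k → f k ≡ true → k ≡ p)
trues≡1⇒unique-true {suc m} f e with f zero in f0
... | true = zero , f0 , only-zero
  where
  only-zero : ∀ k → f k ≡ true → k ≡ zero
  only-zero zero _ = refl
  only-zero (suc k) fk = ⊥-elim (true≢false (trans (sym fk) (trues≡0⇒false (f ∘ suc) (suc-injective e) k)))
... | false =
  let p , fp , only-p = trues≡1⇒unique-true (f ∘ suc) e in
  suc p , fp , λ { zero fk → ⊥-elim (true≢false (trans (sym fk) f0))
                 ; (suc k) fk → cong suc (only-p k fk) }

pick : ∀ {m} → (Fin (suc m) → Bool) → Fin (suc m)
pick {zero} f = zero
pick {suc m} f = if f zero then zero else suc (pick (f ∘ suc))

pick-cong : ∀ {m} {f g : Fin (suc m) → Bool} → (∀ j → f j ≡ g j) → pick f ≡ pick g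
pick-cong {zero} _ = refl
pick-cong {suc m} f≗g rewrite f≗g zero | pick-cong (f≗g ∘ suc) = refl

pick-true : ∀ {m} (f : Fin (suc m) → Bool) j → f j ≡ true → f (pick f) ≡ true
pick-true {zero} f zero fj = fj
pick-true {suc m} f j fj with f zero in f0
... | true = f0
pick-true {suc m} f zero fj | false = ⊥-elim (true≢false (trans (sym fj) f0))
pick-true {suc m} f (suc j) fj | false = pick-true (f ∘ suc) j fj

-- Graphs on Fin (suc n′), rooted forests and their Prüfer-type codes

module Forests (n′ : ℕ) where

  n : ℕ
  n = suc n′

  V : Set
  V = Fin n

  _==_ : V → V → Bool
  i == j = ⌊ i ≟ j ⌋

  ==-refl : ∀ i → (i == i) ≡ true
  ==-refl i with i ≟ i
  ... | yes _ = refl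
  ... | no i≢i = ⊥-elim (i≢i refl)

  ≢⇒==false : ∀ {i j} → i ≢ j → (i == j) ≡ false
  ≢⇒==false {i} {j} i≢j with i ≟ j
  ... | yes i≡j = ⊥-elim (i≢j i≡j)
  ... | no _ = refl

  ==⇒≡ : ∀ {i j} → (i == j) ≡ true → i ≡ j
  ==⇒≡ {i} {j} e with i ≟ j
  ... | yes i≡j = i≡j

  𝟙[_≡_] : V → V → ℕ
  𝟙[ a ≡ j ] = if a == j then 1 else 0

  𝟙-refl : ∀ a → 𝟙[ a ≡ a ] ≡ 1
  𝟙-refl a rewrite ==-refl a = refl

  𝟙-≢ : ∀ {a j} → a ≢ j → 𝟙[ a ≡ j ] ≡ 0
  𝟙-≢ a≢j rewrite ≢⇒==false a≢j = refl

  Symmetric : Graph n → Set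
  Symmetric G = ∀ u v → adj G u v ≡ adj G v u

  Isolated : Graph n → V → Set
  Isolated G v = ∀ k → adj G v k ≡ false

  -- Kept abstract so that adjacency matrices never unfold during type checking.
  abstract
    fromAdj : (V → V → Bool) → Graph n
    fromAdj f = tabulate (λ i → tabulate (f i))

    adj-fromAdj : ∀ f i j → adj (fromAdj f) i j ≡ f i j
    adj-fromAdj f i j rewrite lookup∘tabulate (λ i → tabulate (f i)) i = lookup∘tabulate (f i) j

  graph-ext : (G H : Graph n) → (∀ i j → adj G i j ≡ adj H i j) → G ≡ H
  graph-ext G H G≗H = begin
    G                                           ≡⟨ tabulate∘lookup G ⟨
    tabulate (λ i → lookup G i)                 ≡⟨ tabulate-cong row-ext ⟩
    tabulate (λ i → lookup H i)                 ≡⟨ tabulate∘lookup H ⟩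
    H                                           ∎
    where
    open ≡-Reasoning
    row-ext : ∀ i → lookup G i ≡ lookup H i
    row-ext i = trans (sym (tabulate∘lookup (lookup G i)))
                      (trans (tabulate-cong (G≗H i)) (tabulate∘lookup (lookup H i)))

  deg≡trues : ∀ (G : Graph n) v → deg G v ≡ trues (adj G v)
  deg≡trues G v = trans (cong (count id ∘ toList) (sym (tabulate∘lookup (lookup G v)))) (count-tabulate (adj G v))

  isolated⇒deg≡0 : ∀ (G : Graph n) v → Isolated G v → deg G v ≡ 0
  isolated⇒deg≡0 G v iso = trans (deg≡trues G v) (false⇒trues≡0 _ iso)

  deg≡0⇒isolated : ∀ (G : Graph n) v → deg G v ≡ 0 → Isolated G v
  deg≡0⇒isolated G v d = trues≡0⇒false (adj G v) (trans (sym (deg≡trues G v)) d)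

  emptyGraph : Graph n
  emptyGraph = fromAdj (λ _ _ → false)

  adj-empty : ∀ i j → adj emptyGraph i j ≡ false
  adj-empty = adj-fromAdj (λ _ _ → false)

  isEdge : V → V → V → V → Bool
  isEdge v u i j = (i == v ∧ j == u) ∨ (i == u ∧ j == v)

  removeEdge : Graph n → V → V → Graph n
  removeEdge G v u = fromAdj (λ i j → adj G i j ∧ not (isEdge v u i j))

  addEdge : Graph n → V → V → Graph n
  addEdge G v u = fromAdj (λ i j → adj G i j ∨ isEdge v u i j)

  isEdge-sym : ∀ v u i j → isEdge v u i j ≡ isEdge v u j i
  isEdge-sym v u i j rewrite Bool.∧-comm (i == v) (j == u) | Bool.∧-comm (i == u) (j == v) =
    Bool.∨-comm (j == u ∧ i == v) (j == v ∧ i == u)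

  isEdge⇒ : ∀ v u i j → isEdge v u i j ≡ true → (i ≡ v × j ≡ u) ⊎ (i ≡ u × j ≡ v)
  isEdge⇒ v u i j e with i == v in iv | j == u in ju | i == u in iu | j == v in jv
  ... | true | true | _ | _ = inj₁ (==⇒≡ iv , ==⇒≡ ju)
  ... | true | false | true | true = inj₂ (==⇒≡ iu , ==⇒≡ jv)
  ... | false | _ | true | true = inj₂ (==⇒≡ iu , ==⇒≡ jv)

  isEdge-vu : ∀ v u → isEdge v u v u ≡ true
  isEdge-vu v u rewrite ==-refl v | ==-refl u = refl

  isEdge-uv : ∀ v u → isEdge v u u v ≡ true
  isEdge-uv v u = trans (isEdge-sym v u u v) (isEdge-vu v u)

  ¬isEdge : ∀ v u i j → ¬ ((i ≡ v × j ≡ u) ⊎ (i ≡ u × j ≡ v)) → isEdge v u i j ≡ false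
  ¬isEdge v u i j ¬e with isEdge v u i j in e
  ... | true = ⊥-elim (¬e (isEdge⇒ v u i j e))
  ... | false = refl

  walk-++ : ∀ {G : Graph n} {a b c} → Walk G a b → Walk G b c → Walk G a c
  walk-++ here w = w
  walk-++ (step e w₁) w = step e (walk-++ w₁ w)

  walk-reverse : ∀ {G : Graph n} → Symmetric G → ∀ {a b} → Walk G a b → Walk G b a
  walk-reverse symm here = here
  walk-reverse symm (step {a} {b} e w) = walk-++ (walk-reverse symm w) (step (trans (symm b a) e) here)

  walk-map : ∀ {G H : Graph n} → (∀ {i j} → Adj G i j → Adj H i j) → ∀ {a b} → Walk G a b → Walk H a b
  walk-map G⊆H here = here
  walk-map G⊆H (step e w) = step (G⊆H e) (walk-map G⊆H w)

  isolated⇒walk-trivial : ∀ {G : Graph n} {v y} → Isolated G v → Walk G v y → y ≡ v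
  isolated⇒walk-trivial iso here = refl
  isolated⇒walk-trivial iso (step e _) = ⊥-elim (true≢false (trans (sym e) (iso _)))

  IsLeafEdge : Graph n → V → V → Set
  IsLeafEdge G v u = Adj G v u × (∀ j → Adj G v j → j ≡ u)

  module _ (G : Graph n) (v u : V) where

    adj-removeEdge : ∀ i j → adj (removeEdge G v u) i j ≡ (adj G i j ∧ not (isEdge v u i j))
    adj-removeEdge = adj-fromAdj _

    removeEdge-⊆ : ∀ {i j} → Adj (removeEdge G v u) i j → Adj G i j
    removeEdge-⊆ {i} {j} e rewrite adj-removeEdge i j = Bool.∧-conicalˡ _ _ e

    removeEdge-keeps : ∀ {i j} → Adj G i j → isEdge v u i j ≡ false → Adj (removeEdge G v u) i j
    removeEdge-keeps {i} {j} e ¬vu rewrite adj-removeEdge i j | e | ¬vu = refl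

    removeEdge-symmetric : Symmetric G → Symmetric (removeEdge G v u)
    removeEdge-symmetric symm i j rewrite adj-removeEdge i j | adj-removeEdge j i | symm i j | isEdge-sym v u i j = refl

    removeEdge-vu : adj (removeEdge G v u) v u ≡ false
    removeEdge-vu rewrite adj-removeEdge v u | isEdge-vu v u = Bool.∧-zeroʳ _

    removeEdge-uv : adj (removeEdge G v u) u v ≡ false
    removeEdge-uv rewrite adj-removeEdge u v | isEdge-uv v u = Bool.∧-zeroʳ _

    removeEdge-leaf-isolated : IsLeafEdge G v u → Isolated (removeEdge G v u) v
    removeEdge-leaf-isolated (_ , only-u) k with adj G v k in vk
    ... | false = trans (adj-removeEdge v k) (cong (_∧ _) vk)
    ... | true with only-u k vk
    ... | refl = removeEdge-vu

    adj-addEdge : ∀ i j → adj (addEdge G v u) i j ≡ (adj G i j ∨ isEdge v u i j)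
    adj-addEdge = adj-fromAdj _

    addEdge-⊇ : ∀ {i j} → Adj G i j → Adj (addEdge G v u) i j
    addEdge-⊇ {i} {j} e rewrite adj-addEdge i j | e = refl

    addEdge-vu : Adj (addEdge G v u) v u
    addEdge-vu rewrite adj-addEdge v u | isEdge-vu v u = Bool.∨-zeroʳ _

    addEdge-symmetric : Symmetric G → Symmetric (addEdge G v u)
    addEdge-symmetric symm i j rewrite adj-addEdge i j | adj-addEdge j i | symm i j | isEdge-sym v u i j = refl

    addEdge-away-from : ∀ {i j} → Adj (addEdge G v u) i j → i ≢ v → j ≢ v → Adj G i j
    addEdge-away-from {i} {j} e i≢v j≢v =
      trans (sym (Bool.∨-identityʳ _))
        (trans (cong (adj G i j ∨_) (sym (¬isEdge v u i j λ { (inj₁ (i≡v , _)) → i≢v i≡v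
                                                                ; (inj₂ (_ , j≡v)) → j≢v j≡v })))
          (trans (sym (adj-addEdge i j)) e))

    addEdge-isolated-leaf : Isolated G v → u ≢ v → IsLeafEdge (addEdge G v u) v u
    addEdge-isolated-leaf iso u≢v = addEdge-vu , only-u
      where
      only-u : ∀ j → Adj (addEdge G v u) v j → j ≡ u
      only-u j e rewrite adj-addEdge v j | iso j with isEdge⇒ v u v j e
      ... | inj₁ (_ , j≡u) = j≡u
      ... | inj₂ (v≡u , _) = ⊥-elim (u≢v (sym v≡u))

  deg-removeEdge : ∀ (G : Graph n) → Symmetric G → ∀ {v u} → Adj G v u → u ≢ v
    → ∀ j → deg G j ≡ 𝟙[ u ≡ j ] + 𝟙[ v ≡ j ] + deg (removeEdge G v u) j
  deg-removeEdge G symm {v} {u} vu u≢v j rewrite deg≡trues G j | deg≡trues (removeEdge G v u) j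
    with j ≟ v | j ≟ u
  ... | yes refl | yes j≡u = ⊥-elim (u≢v (sym j≡u))
  ... | yes refl | no _ rewrite 𝟙-≢ u≢v | 𝟙-refl j =
    trues-unset _ _ u vu (removeEdge-vu G j u) unchanged
    where
    unchanged : ∀ k → k ≢ u → adj G j k ≡ adj (removeEdge G j u) j k
    unchanged k k≢u rewrite adj-removeEdge G j u j k
      | ¬isEdge j u j k (λ { (inj₁ (_ , k≡u)) → k≢u k≡u ; (inj₂ (j≡u , _)) → u≢v (sym j≡u) }) =
      sym (Bool.∧-identityʳ _)
  ... | no j≢v | yes refl rewrite 𝟙-refl j | 𝟙-≢ (j≢v ∘ sym) =
    trues-unset _ _ v (trans (symm j v) vu) (removeEdge-uv G v j) unchanged
    where
    unchanged : ∀ k → k ≢ v → adj G j k ≡ adj (removeEdge G v j) j k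
    unchanged k k≢v rewrite adj-removeEdge G v j j k
      | ¬isEdge v j j k (λ { (inj₁ (j≡v , _)) → j≢v j≡v ; (inj₂ (_ , k≡v)) → k≢v k≡v }) =
      sym (Bool.∧-identityʳ _)
  ... | no j≢v | no j≢u rewrite 𝟙-≢ (j≢u ∘ sym) | 𝟙-≢ (j≢v ∘ sym) = trues-cong unchanged
    where
    unchanged : ∀ k → adj G j k ≡ adj (removeEdge G v u) j k
    unchanged k rewrite adj-removeEdge G v u j k
      | ¬isEdge v u j k (λ { (inj₁ (j≡v , _)) → j≢v j≡v ; (inj₂ (j≡u , _)) → j≢u j≡u }) =
      sym (Bool.∧-identityʳ _)

  addEdge-removeEdge : ∀ (G : Graph n) → Symmetric G → ∀ {v u} → Adj G v u → addEdge (removeEdge G v u) v u ≡ G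
  addEdge-removeEdge G symm {v} {u} vu = graph-ext _ _ same
    where
    same : ∀ i j → adj (addEdge (removeEdge G v u) v u) i j ≡ adj G i j
    same i j rewrite adj-addEdge (removeEdge G v u) v u i j | adj-removeEdge G v u i j with isEdge v u i j in e
    ... | false = trans (Bool.∨-identityʳ _) (Bool.∧-identityʳ _)
    ... | true with isEdge⇒ v u i j e
    ... | inj₁ (refl , refl) = trans (Bool.∨-zeroʳ _) (sym vu)
    ... | inj₂ (refl , refl) = trans (Bool.∨-zeroʳ _) (sym (trans (symm u v) vu))

  removeEdge-addEdge : ∀ (G : Graph n) → Symmetric G → ∀ {v} u → Isolated G v → removeEdge (addEdge G v u) v u ≡ G
  removeEdge-addEdge G symm {v} u iso = graph-ext _ _ same
    where
    same : ∀ i j → adj (removeEdge (addEdge G v u) v u) i j ≡ adj G i j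
    same i j rewrite adj-removeEdge (addEdge G v u) v u i j | adj-addEdge G v u i j with isEdge v u i j in e
    ... | false = trans (Bool.∧-identityʳ _) (Bool.∨-identityʳ _)
    ... | true with isEdge⇒ v u i j e
    ... | inj₁ (refl , refl) = trans (Bool.∧-zeroʳ _) (sym (iso j))
    ... | inj₂ (refl , refl) = trans (Bool.∧-zeroʳ _) (sym (trans (symm i v) (iso i)))

  record IsRootedForest (S : V → Bool) (G : Graph n) : Set where
    field
      symmetric : Symmetric G
      loopless : ∀ u → adj G u u ≡ false
      acyclic : ¬ HasCycle G
      root : V → V
      root-isRoot : ∀ x → S (root x) ≡ true
      walk-to-root : ∀ x → Walk G x (root x)
      roots-disconnected : ∀ r r′ → S r ≡ true → S r′ ≡ true → Walk G r r′ → r ≡ r′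

  open IsRootedForest

  NonRoot : (V → Bool) → V → Set
  NonRoot S j = S j ≡ false

  addRoot : (V → Bool) → V → V → Bool
  addRoot S v j = S j ∨ (j == v)

  addRoot-cases : ∀ S v {j} → addRoot S v j ≡ true → S j ≡ true ⊎ j ≡ v
  addRoot-cases S v {j} e with S j
  ... | true = inj₁ refl
  ... | false = inj₂ (==⇒≡ e)

  addRoot-old : ∀ S v {j} → S j ≡ true → addRoot S v j ≡ true
  addRoot-old S v e rewrite e = refl

  addRoot-new : ∀ S v → addRoot S v v ≡ true
  addRoot-new S v rewrite ==-refl v = Bool.∨-zeroʳ (S v)

  addRoot-other : ∀ S v {j} → j ≢ v → addRoot S v j ≡ S j
  addRoot-other S v j≢v rewrite ≢⇒==false j≢v = Bool.∨-identityʳ _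

  nonRoot⇒≢root : ∀ {S r v} → S r ≡ true → NonRoot S v → r ≢ v
  nonRoot⇒≢root Sr Sv refl = true≢false (trans (sym Sr) Sv)

  module _ {G : Graph n} (G-sym : Symmetric G) {v u : V} (leaf : IsLeafEdge G v u) (u≢v : u ≢ v) where

    -- A walk entering the leaf v comes from u and returns to u, so that detour can be cut out.
    walk-avoiding-leaf : ∀ {x r} → Walk G x r → x ≢ v → r ≢ v → Walk (removeEdge G v u) x r
    walk-avoiding-leaf here _ _ = here
    walk-avoiding-leaf (step {v = y} e w) x≢v r≢v with y ≟ v
    ... | no y≢v = step (removeEdge-keeps G v u e (¬isEdge v u _ _ λ { (inj₁ (x≡v , _)) → x≢v x≡v
                                                                      ; (inj₂ (_ , y≡v)) → y≢v y≡v }))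
                        (walk-avoiding-leaf w y≢v r≢v)
    walk-avoiding-leaf (step e here) x≢v r≢v | yes refl = ⊥-elim (r≢v refl)
    walk-avoiding-leaf (step {u = x} e (step {v = z} e₂ w₂)) x≢v r≢v | yes refl
      with proj₂ leaf z e₂ | proj₂ leaf x (trans (G-sym _ x) e)
    ... | refl | refl = walk-avoiding-leaf w₂ u≢v r≢v

  leaf-irreflexive : ∀ {S G v u} → IsRootedForest S G → IsLeafEdge G v u → u ≢ v
  leaf-irreflexive F (vu , _) refl = true≢false (trans (sym vu) (loopless F _))

  -- The deleted leaf stays behind as an isolated vertex and becomes the root of its own component.
  removeLeaf-rootedForest : ∀ {S G v u} → IsRootedForest S G → NonRoot S v → IsLeafEdge G v u
    → IsRootedForest (addRoot S v) (removeEdge G v u)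
  removeLeaf-rootedForest {S} {G} {v} {u} F Sv leaf = record
    { symmetric = removeEdge-symmetric G v u (symmetric F)
    ; loopless = λ i → Bool.¬-not (λ ii → true≢false (trans (sym (removeEdge-⊆ G v u ii)) (loopless F i)))
    ; acyclic = λ (c , ws , len , u′ , l) → acyclic F (c , ws , len , u′ , Linked.map (removeEdge-⊆ G v u) l)
    ; root = root′
    ; root-isRoot = root′-isRoot
    ; walk-to-root = walk-to-root′
    ; roots-disconnected = disconnected
    }
    where
    G⁻ : Graph n
    G⁻ = removeEdge G v u
    v-isolated : Isolated G⁻ v
    v-isolated = removeEdge-leaf-isolated G v u leaf
    root′ : V → V
    root′ x with x ≟ v
    ... | yes _ = v
    ... | no _ = root F x
    root′-isRoot : ∀ x → addRoot S v (root′ x) ≡ true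
    root′-isRoot x with x ≟ v
    ... | yes _ = addRoot-new S v
    ... | no _ = addRoot-old S v (root-isRoot F x)
    walk-to-root′ : ∀ x → Walk G⁻ x (root′ x)
    walk-to-root′ x with x ≟ v
    ... | yes refl = here
    ... | no x≢v = walk-avoiding-leaf (symmetric F) leaf (leaf-irreflexive F leaf) (walk-to-root F x) x≢v
                     (nonRoot⇒≢root (root-isRoot F x) Sv)
    disconnected : ∀ r r′ → addRoot S v r ≡ true → addRoot S v r′ ≡ true → Walk G⁻ r r′ → r ≡ r′
    disconnected r r′ Sr Sr′ w with addRoot-cases S v Sr | addRoot-cases S v Sr′
    ... | inj₁ Sr | inj₁ Sr′ = roots-disconnected F r r′ Sr Sr′ (walk-map (removeEdge-⊆ G v u) w)
    ... | inj₂ refl | _ = sym (isolated⇒walk-trivial v-isolated w)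
    ... | inj₁ _ | inj₂ refl =
      isolated⇒walk-trivial v-isolated (walk-reverse (removeEdge-symmetric G v u (symmetric F)) w)

  addEdge-loopless : ∀ (G : Graph n) → (∀ i → adj G i i ≡ false) → ∀ {v u} → u ≢ v
    → ∀ i → adj (addEdge G v u) i i ≡ false
  addEdge-loopless G G-loopless {v} {u} u≢v i rewrite adj-addEdge G v u i i | G-loopless i =
    ¬isEdge v u i i λ { (inj₁ (i≡v , i≡u)) → u≢v (trans (sym i≡u) i≡v)
                      ; (inj₂ (i≡u , i≡v)) → u≢v (trans (sym i≡u) i≡v) }

  addLeaf-acyclic : ∀ (G : Graph n) → Symmetric G → ∀ {v u} → Isolated G v → u ≢ v
    → ¬ HasCycle G → ¬ HasCycle (addEdge G v u)
  addLeaf-acyclic G G-sym {v} {u} iso u≢v acyclic (c , ws , len , unique , l) with any? (v ≟_) (c ∷ ws)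
  ... | yes v∈cycle =
    let a , b , a≢b , av , vb = cycle-neighbours c ws len unique l v∈cycle in
    a≢b (trans (only-u a (trans (addEdge-symmetric G v u G-sym v a) av)) (sym (only-u b vb)))
    where
    only-u : ∀ j → Adj (addEdge G v u) v j → j ≡ u
    only-u = proj₂ (addEdge-isolated-leaf G v u iso u≢v)
  ... | no v∉cycle = acyclic (c , ws , len , unique , Linked-restrict away avoids-v l)
    where
    avoids-v : All (v ≢_) ((c ∷ ws) ∷ʳ c)
    avoids-v = ++⁺ (¬Any⇒All¬ _ v∉cycle) ((λ v≡c → v∉cycle (here v≡c)) ∷ [])
    away : ∀ {a b} → v ≢ a → v ≢ b → Adj (addEdge G v u) a b → Adj G a b
    away v≢a v≢b e = addEdge-away-from G v u e (v≢a ∘ sym) (v≢b ∘ sym)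

  addLeaf-rootedForest : ∀ {S G v u} → IsRootedForest (addRoot S v) G → Isolated G v → u ≢ v → NonRoot S v
    → IsRootedForest S (addEdge G v u)
  addLeaf-rootedForest {S} {G} {v} {u} F iso u≢v Sv = record
    { symmetric = G⁺-sym
    ; loopless = addEdge-loopless G (loopless F) u≢v
    ; acyclic = addLeaf-acyclic G (symmetric F) iso u≢v (acyclic F)
    ; root = root⁺
    ; root-isRoot = root⁺-isRoot
    ; walk-to-root = walk-to-root⁺
    ; roots-disconnected = disconnected
    }
    where
    G⁺ : Graph n
    G⁺ = addEdge G v u
    G⁺-sym : Symmetric G⁺
    G⁺-sym = addEdge-symmetric G v u (symmetric F)
    leaf : IsLeafEdge G⁺ v u
    leaf = addEdge-isolated-leaf G v u iso u≢v
    G⁺⁻≡G : removeEdge G⁺ v u ≡ G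
    G⁺⁻≡G = removeEdge-addEdge G (symmetric F) u iso
    lift : ∀ {i j} → Adj G i j → Adj G⁺ i j
    lift = addEdge-⊇ G v u

    root-u-isRoot : S (root F u) ≡ true
    root-u-isRoot with addRoot-cases S v (root-isRoot F u)
    ... | inj₁ Sr = Sr
    ... | inj₂ r≡v = ⊥-elim (u≢v (isolated⇒walk-trivial iso
                      (walk-reverse (symmetric F) (subst (Walk G u) r≡v (walk-to-root F u)))))

    root⁺ : V → V
    root⁺ x with root F x ≟ v
    ... | yes _ = root F u
    ... | no _ = root F x

    root⁺-isRoot : ∀ x → S (root⁺ x) ≡ true
    root⁺-isRoot x with root F x ≟ v
    ... | yes _ = root-u-isRoot
    ... | no r≢v = trans (sym (addRoot-other S v r≢v)) (root-isRoot F x)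

    walk-to-root⁺ : ∀ x → Walk G⁺ x (root⁺ x)
    walk-to-root⁺ x with root F x ≟ v
    ... | yes r≡v = walk-++ (walk-map lift (subst (Walk G x) r≡v (walk-to-root F x)))
                            (step (proj₁ leaf) (walk-map lift (walk-to-root F u)))
    ... | no _ = walk-map lift (walk-to-root F x)

    disconnected : ∀ r r′ → S r ≡ true → S r′ ≡ true → Walk G⁺ r r′ → r ≡ r′
    disconnected r r′ Sr Sr′ w =
      roots-disconnected F r r′ (addRoot-old S v Sr) (addRoot-old S v Sr′)
        (subst (λ H → Walk H r r′) G⁺⁻≡G
          (walk-avoiding-leaf G⁺-sym leaf u≢v w (nonRoot⇒≢root Sr Sv) (nonRoot⇒≢root Sr′ Sv)))

  Linked⇒walk : ∀ {G : Graph n} {h xs x} → Linked (Adj G) (h ∷ xs) → x ∈ h ∷ xs → Walk G h x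
  Linked⇒walk _ (here refl) = here
  Linked⇒walk (e ∷ l) (there x∈) = step e (Linked⇒walk l x∈)

  path-chord⇒cycle : ∀ {G : Graph n} → Symmetric G → ∀ {y p rest z} → Linked (Adj G) (y ∷ p ∷ rest)
    → Unique (y ∷ p ∷ rest) → z ∈ rest → Adj G y z → HasCycle G
  path-chord⇒cycle {G} G-sym {y} {p} {z = z} l u z∈rest yz with ∈-∃++ z∈rest
  ... | as , bs , refl =
    y , p ∷ as ∷ʳ z , s≤s (length-∷ʳ≥1 as) ,
    Unique-++⁻ˡ (y ∷ p ∷ as ∷ʳ z) (subst Unique reassoc u) ,
    Linked-∷ʳ (y ∷ p ∷ as) (Linked-++⁻ˡ (y ∷ p ∷ as ∷ʳ z) (subst (Linked (Adj G)) reassoc l))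
              (trans (G-sym z y) yz)
    where
    reassoc : y ∷ p ∷ as ++ z ∷ bs ≡ (y ∷ p ∷ as ∷ʳ z) ++ bs
    reassoc = cong (λ l → y ∷ p ∷ l) (sym (++-assoc as (z ∷ []) bs))
    length-∷ʳ≥1 : ∀ (xs : List V) {x} → 1 ≤ length (xs ∷ʳ x)
    length-∷ʳ≥1 [] = s≤s z≤n
    length-∷ʳ≥1 (_ ∷ _) = s≤s z≤n

  unique⇒length≤n : ∀ {P : List V} → Unique P → length P ≤ n
  unique⇒length≤n {P} u = subst (length P ≤_) (length-tabulate id) (unique-⊆⇒length-≤ u (λ _ → ∈-allFin _))

  module _ {S : V → Bool} {G : Graph n} (F : IsRootedForest S G) {r : V} (Sr : S r ≡ true) where

    private
      LeafFound : Set
      LeafFound = Σ V λ y → NonRoot S y × deg G y ≡ 1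

      saturated-path-end-is-leaf : ∀ y p rest → Linked (Adj G) (y ∷ p ∷ rest) → Unique (y ∷ p ∷ rest)
        → r ∈ p ∷ rest → (∀ z → Adj G y z → z ∈ y ∷ p ∷ rest) → LeafFound
      saturated-path-end-is-leaf y p rest l@(yp ∷ _) u@(y∉ ∷ _) r∈ closed =
        y , Bool.¬-not y-not-root , trans (deg≡trues G y) (unique-true⇒trues≡1 (adj G y) p yp only-p)
        where
        y-not-root : S y ≢ true
        y-not-root Sy = All.lookup y∉ r∈ (roots-disconnected F y r Sy Sr (Linked⇒walk {G} l (there r∈)))
        only-p : ∀ z → Adj G y z → z ≡ p
        only-p z yz with closed z yz
        ... | here refl = ⊥-elim (true≢false (trans (sym yz) (loopless F z)))
        ... | there (here refl) = refl
        ... | there (there z∈rest) = ⊥-elim (acyclic F (path-chord⇒cycle {G} (symmetric F) l u z∈rest yz))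

      -- Grow a path away from r until its far end has no new neighbour; fuel bounds its length by n.
      extend-path : (fuel : ℕ) → ∀ y p rest → Linked (Adj G) (y ∷ p ∷ rest) → Unique (y ∷ p ∷ rest)
        → r ∈ p ∷ rest → length (y ∷ p ∷ rest) + fuel ≡ suc n → LeafFound
      extend-path zero y p rest l u r∈ len =
        ⊥-elim (ℕ.<-irrefl refl (subst (_≤ n) (trans (sym (+-identityʳ _)) len) (unique⇒length≤n u)))
      extend-path (suc fuel) y p rest l u r∈ len
        with Fin.any? (λ z → (adj G y z Bool.≟ true) ×-dec ¬? (any? (z ≟_) (y ∷ p ∷ rest)))
      ... | yes (z , yz , z∉) = extend-path fuel z y (p ∷ rest) (trans (symmetric F z y) yz ∷ l)
                                  (¬Any⇒All¬ _ z∉ ∷ u) (there r∈) (trans (sym (ℕ.+-suc _ fuel)) len)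
      ... | no no-new-neighbour = saturated-path-end-is-leaf y p rest l u r∈ closed
        where
        closed : ∀ z → Adj G y z → z ∈ y ∷ p ∷ rest
        closed z yz with any? (z ≟_) (y ∷ p ∷ rest)
        ... | yes z∈ = z∈
        ... | no z∉ = ⊥-elim (no-new-neighbour (z , yz , z∉))

    leaf-beyond : ∀ {x} → Adj G r x → Σ V λ y → NonRoot S y × deg G y ≡ 1
    leaf-beyond {x} rx =
      extend-path n′ x r [] (trans (symmetric F x r) rx ∷ [-]) ((x≢r ∷ []) ∷ [] ∷ []) (here refl) refl
      where
      x≢r : x ≢ r
      x≢r refl = true≢false (trans (sym rx) (loopless F x))

  nonRoot-leaf : ∀ {S G} → IsRootedForest S G → ∀ {w} → NonRoot S w → Σ V λ y → NonRoot S y × deg G y ≡ 1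
  nonRoot-leaf {S} {G} F {w} Sw = from-root (root-isRoot F w) Sw (walk-reverse (symmetric F) (walk-to-root F w))
    where
    from-root : ∀ {a b} → S a ≡ true → NonRoot S b → Walk G a b → Σ V λ y → NonRoot S y × deg G y ≡ 1
    from-root Sa Sb here = ⊥-elim (true≢false (trans (sym Sa) Sb))
    from-root Sa Sb (step ax _) = leaf-beyond F Sa ax

  emptyGraph-rootedForest : ∀ {S} → (∀ j → S j ≡ true) → IsRootedForest S emptyGraph
  emptyGraph-rootedForest all-roots = record
    { symmetric = λ i j → trans (adj-empty i j) (sym (adj-empty j i))
    ; loopless = λ i → adj-empty i i
    ; acyclic = λ { (_ , _ ∷ _ , _ , _ , e ∷ _) → true≢false (trans (sym e) (adj-empty _ _)) }
    ; root = id
    ; root-isRoot = all-roots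
    ; walk-to-root = λ _ → here
    ; roots-disconnected = λ _ _ _ _ w → sym (isolated⇒walk-trivial (adj-empty _) w)
    }

  allRoots⇒empty : ∀ {S G} → IsRootedForest S G → (∀ j → S j ≡ true) → G ≡ emptyGraph
  allRoots⇒empty {S} {G} F all-roots = graph-ext _ _ no-edges
    where
    no-edges : ∀ i j → adj G i j ≡ adj emptyGraph i j
    no-edges i j rewrite adj-empty i j = Bool.¬-not λ ij →
      true≢false (trans (sym ij) (subst (λ k → adj G i k ≡ false)
        (roots-disconnected F i j (all-roots i) (all-roots j) (step ij here)) (loopless F i)))

  deg-addLeaf : ∀ (G : Graph n) → Symmetric G → ∀ {v} u → Isolated G v → u ≢ v
    → ∀ j → deg (addEdge G v u) j ≡ 𝟙[ u ≡ j ] + 𝟙[ v ≡ j ] + deg G j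
  deg-addLeaf G G-sym {v} u iso u≢v j =
    subst (λ H → deg (addEdge G v u) j ≡ 𝟙[ u ≡ j ] + 𝟙[ v ≡ j ] + deg H j)
      (removeEdge-addEdge G G-sym u iso)
      (deg-removeEdge (addEdge G v u) (addEdge-symmetric G v u G-sym) (addEdge-vu G v u) u≢v j)

  -- The leaf is chosen from a degree function, so that decoding can recompute the choice
  -- from the code alone (see codeDegree).
  leastLeaf : (V → Bool) → (V → ℕ) → V
  leastLeaf S δ = pick (λ j → not (S j) ∧ (δ j ≡ᵇ 1))

  leastLeaf-spec : ∀ S δ {j} → NonRoot S j → δ j ≡ 1 → NonRoot S (leastLeaf S δ) × δ (leastLeaf S δ) ≡ 1
  leastLeaf-spec S δ {j} Sj δj
    with pick-true (λ j → not (S j) ∧ (δ j ≡ᵇ 1)) j (cong₂ (λ b d → not b ∧ (d ≡ᵇ 1)) Sj δj)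
  ... | chosen with S (leastLeaf S δ)
  ... | false = refl , ℕ.≡ᵇ⇒≡ _ 1 (subst T (sym chosen) tt)

  leastLeaf-cong : ∀ S {δ δ′ : V → ℕ} → (∀ j → δ j ≡ δ′ j) → leastLeaf S δ ≡ leastLeaf S δ′
  leastLeaf-cong S δ≗δ′ = pick-cong (λ j → cong (λ d → not (S j) ∧ (d ≡ᵇ 1)) (δ≗δ′ j))

  neighbour : Graph n → V → V
  neighbour G v = pick (adj G v)

  deg≡1⇒leaf : ∀ G v → deg G v ≡ 1 → IsLeafEdge G v (neighbour G v)
  deg≡1⇒leaf G v d with trues≡1⇒unique-true (adj G v) (trans (sym (deg≡trues G v)) d)
  ... | p , vp , only-p = subst (Adj G v) (sym neighbour≡p) vp , λ j vj → trans (only-p j vj) (sym neighbour≡p)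
    where
    neighbour≡p : neighbour G v ≡ p
    neighbour≡p = only-p _ (pick-true (adj G v) p vp)

  leaf⇒neighbour : ∀ G v u → IsLeafEdge G v u → neighbour G v ≡ u
  leaf⇒neighbour G v u (vu , only-u) = only-u _ (pick-true (adj G v) u vu)

  load-∷ : ∀ {K} u (w : Vec V K) j → load (u ∷ w) j ≡ 𝟙[ u ≡ j ] + load w j
  load-∷ u w j with u ≟ j
  ... | yes _ = refl
  ... | no _ = refl

  load-∷ʳ : ∀ {K} (w : Vec V K) x j → load (w Vec.∷ʳ x) j ≡ load w j + 𝟙[ x ≡ j ]
  load-∷ʳ [] x j = trans (load-∷ x [] j) (+-comm 𝟙[ x ≡ j ] 0)
  load-∷ʳ (y ∷ w) x j = begin
    load (y ∷ (w Vec.∷ʳ x)) j            ≡⟨ load-∷ y (w Vec.∷ʳ x) j ⟩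
    𝟙[ y ≡ j ] + load (w Vec.∷ʳ x) j     ≡⟨ cong (𝟙[ y ≡ j ] +_) (load-∷ʳ w x j) ⟩
    𝟙[ y ≡ j ] + (load w j + 𝟙[ x ≡ j ]) ≡⟨ +-assoc 𝟙[ y ≡ j ] (load w j) 𝟙[ x ≡ j ] ⟨
    𝟙[ y ≡ j ] + load w j + 𝟙[ x ≡ j ]   ≡⟨ cong (_+ 𝟙[ x ≡ j ]) (load-∷ y w j) ⟨
    load (y ∷ w) j + 𝟙[ x ≡ j ]          ∎
    where open ≡-Reasoning

  ∈⇒load≢0 : ∀ {K} (w : Vec V K) {j} → j ∈ toList w → load w j ≢ 0
  ∈⇒load≢0 (u ∷ w) {j} j∈ l0 with u ≟ j | j∈
  ... | no u≢j | here refl = u≢j refl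
  ... | no _ | there j∈w = ∈⇒load≢0 w j∈w l0

  load≢0⇒∈ : ∀ {K} (w : Vec V K) j → load w j ≢ 0 → j ∈ toList w
  load≢0⇒∈ [] j l≢0 = ⊥-elim (l≢0 refl)
  load≢0⇒∈ (u ∷ w) j l≢0 with u ≟ j
  ... | yes refl = here refl
  ... | no _ = there (load≢0⇒∈ w j l≢0)

  last-∈ : ∀ {K} (w : Vec V (suc K)) → last w ∈ toList w
  last-∈ (x ∷ []) = here refl
  last-∈ (x ∷ y ∷ w) = there (last-∈ (y ∷ w))

  ∈-init : ∀ {K} (w : Vec V (suc K)) {j} → j ∈ toList w → j ≢ last w → j ∈ toList (init w)
  ∈-init (x ∷ []) (here refl) j≢last = ⊥-elim (j≢last refl)
  ∈-init (x ∷ y ∷ w) (here refl) _ = here refl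
  ∈-init (x ∷ y ∷ w) (there j∈) j≢last = there (∈-init (y ∷ w) j∈ j≢last)

  𝟙[¬_] : Bool → ℕ
  𝟙[¬ b ] = if b then 0 else 1

  isNonRoot : (V → Bool) → V → ℕ
  isNonRoot S j = 𝟙[¬ S j ]

  codeDegree : ∀ {K} → (V → Bool) → Vec V K → V → ℕ
  codeDegree S w j = load w j + isNonRoot S j

  -- The last leaf removed by encode is attached to a root.
  EndsInRoot : ∀ {K} → (V → Bool) → Vec V K → Set
  EndsInRoot S [] = ⊤
  EndsInRoot S (x ∷ w) = S (last (x ∷ w)) ≡ true

  isNonRoot-addRoot : ∀ S {v} → NonRoot S v → ∀ j → isNonRoot S j ≡ 𝟙[ v ≡ j ] + isNonRoot (addRoot S v) j
  isNonRoot-addRoot S {v} Sv j with j ≟ v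
  ... | yes refl = trans (cong 𝟙[¬_] Sv) (sym (cong₂ _+_ (𝟙-refl _) (cong 𝟙[¬_] (Bool.∨-zeroʳ (S _)))))
  ... | no j≢v = sym (cong₂ (λ a b → a + 𝟙[¬ b ]) (𝟙-≢ (j≢v ∘ sym)) (Bool.∨-identityʳ (S j)))

  codeDegree-∷ : ∀ {K} S {v} u (w : Vec V K) → NonRoot S v
    → ∀ j → codeDegree S (u ∷ w) j ≡ 𝟙[ u ≡ j ] + 𝟙[ v ≡ j ] + codeDegree (addRoot S v) w j
  codeDegree-∷ S {v} u w Sv j = begin
    load (u ∷ w) j + isNonRoot S j
      ≡⟨ cong₂ _+_ (load-∷ u w j) (isNonRoot-addRoot S Sv j) ⟩
    (𝟙[ u ≡ j ] + load w j) + (𝟙[ v ≡ j ] + isNonRoot (addRoot S v) j)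
      ≡⟨ interchange 𝟙[ u ≡ j ] (load w j) 𝟙[ v ≡ j ] (isNonRoot (addRoot S v) j) ⟩
    𝟙[ u ≡ j ] + 𝟙[ v ≡ j ] + codeDegree (addRoot S v) w j
      ∎
    where open ≡-Reasoning

  HasCount-addRoot : ∀ {S K v} → HasCount (NonRoot S) (suc K) → NonRoot S v → HasCount (NonRoot (addRoot S v)) K
  HasCount-addRoot {S} {K} {v} cnt Sv = HasCount-cong nonRoot⇔ (HasCount-remove cnt Sv)
    where
    nonRoot⇔ : ∀ j → (NonRoot S j × j ≢ v) ⇔ NonRoot (addRoot S v) j
    nonRoot⇔ j = mk⇔ (λ (Sj , j≢v) → trans (addRoot-other S v j≢v) Sj)
                      (λ S⁺j → Bool.¬-not (λ Sj → true≢false (trans (sym (addRoot-old S v Sj)) S⁺j))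
                             , λ { refl → true≢false (trans (sym (addRoot-new S j)) S⁺j) })

  noNonRoots⇒allRoots : ∀ {S} → HasCount (NonRoot S) 0 → ∀ j → S j ≡ true
  noNonRoots⇒allRoots cnt j = Bool.¬-not (HasCount-zero cnt j)

  code-has-leaf : ∀ {K S} (w : Vec V (suc K)) → HasCount (NonRoot S) (suc K) → EndsInRoot S w
    → Σ V λ j → NonRoot S j × codeDegree S w j ≡ 1
  code-has-leaf {K} {S} w@(_ ∷ _) cnt ends
    with Fin.any? (λ j → (S j Bool.≟ false) ×-dec (codeDegree S w j ℕ.≟ 1))
  ... | yes found = found
  ... | no none = ⊥-elim (ℕ.<-irrefl refl (subst (suc K ≤_) (length-toList (init w))
                    (HasCount-≤ cnt (toList (init w)) nonRoot∈init)))
    where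
    nonRoot∈init : ∀ {j} → NonRoot S j → j ∈ toList (init w)
    nonRoot∈init {j} Sj = ∈-init w (load≢0⇒∈ w j load≢0) (nonRoot⇒≢root ends Sj ∘ sym)
      where
      load≢0 : load w j ≢ 0
      load≢0 l0 = none (j , Sj , cong₂ (λ l b → l + 𝟙[¬ b ]) l0 Sj)

  endsInRoot-∷ : ∀ {K S v u} (w : Vec V K) → HasCount (NonRoot (addRoot S v)) K → EndsInRoot (addRoot S v) w
    → load w v ≡ 0 → u ≢ v → EndsInRoot S (u ∷ w)
  endsInRoot-∷ {S = S} {v} {u} [] cnt _ _ u≢v with addRoot-cases S v (noNonRoots⇒allRoots cnt u)
  ... | inj₁ Su = Su
  ... | inj₂ u≡v = ⊥-elim (u≢v u≡v)
  endsInRoot-∷ {S = S} {v} w@(_ ∷ _) _ ends lv0 _ with addRoot-cases S v ends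
  ... | inj₁ S-last = S-last
  ... | inj₂ last≡v = ⊥-elim (∈⇒load≢0 w (subst (_∈ toList w) last≡v (last-∈ w)) lv0)

  endsInRoot-∷ʳ : ∀ {K} S (w : Vec V K) {x} → S x ≡ true → EndsInRoot S (w Vec.∷ʳ x)
  endsInRoot-∷ʳ S [] Sx = Sx
  endsInRoot-∷ʳ S w@(_ ∷ _) {x} Sx = trans (cong S (last-∷ʳ x w)) Sx

  endsInRoot-tail : ∀ {K} S v {u} (w : Vec V K) → EndsInRoot S (u ∷ w) → EndsInRoot (addRoot S v) w
  endsInRoot-tail S v [] _ = tt
  endsInRoot-tail S v (_ ∷ _) ends = addRoot-old S v ends

  encode : ∀ K → (V → Bool) → Graph n → Vec V K
  encode zero S G = []
  encode (suc K) S G =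
    let v = leastLeaf S (deg G) ; u = neighbour G v in
    u ∷ encode K (addRoot S v) (removeEdge G v u)

  decode : ∀ K → (V → Bool) → Vec V K → Graph n
  decode zero S [] = emptyGraph
  decode (suc K) S (u ∷ w) =
    let v = leastLeaf S (codeDegree S (u ∷ w)) in
    addEdge (decode K (addRoot S v) w) v u

  root⇒codeDegree≡load : ∀ {K} S j (w : Vec V K) → S j ≡ true → codeDegree S w j ≡ load w j
  root⇒codeDegree≡load S j w Sj rewrite Sj = +-identityʳ (load w j)

  codeDegree-[] : ∀ {S} → (∀ j → S j ≡ true) → ∀ j → codeDegree S [] j ≡ 0
  codeDegree-[] {S} all-roots j = root⇒codeDegree≡load S j [] (all-roots j)

  deg-empty : ∀ j → deg emptyGraph j ≡ 0
  deg-empty j = isolated⇒deg≡0 emptyGraph j (adj-empty j)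

  forest-leastLeaf : ∀ {K S G} → HasCount (NonRoot S) (suc K) → IsRootedForest S G
    → NonRoot S (leastLeaf S (deg G)) × IsLeafEdge G (leastLeaf S (deg G)) (neighbour G (leastLeaf S (deg G)))
  forest-leastLeaf {S = S} {G} cnt F =
    let _ , Sw = HasCount-suc⇒inhabited cnt
        _ , Sy , dy = nonRoot-leaf F Sw
        Sv , dv = leastLeaf-spec S (deg G) Sy dy
    in Sv , deg≡1⇒leaf G _ dv

  code-leastLeaf : ∀ {K S} u (w : Vec V K) → HasCount (NonRoot S) (suc K) → EndsInRoot S (u ∷ w)
    → NonRoot S (leastLeaf S (codeDegree S (u ∷ w)))
      × u ≢ leastLeaf S (codeDegree S (u ∷ w)) × load w (leastLeaf S (codeDegree S (u ∷ w))) ≡ 0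
  code-leastLeaf {S = S} u w cnt ends = Sv , u≢v , ℕ.m+n≡0⇒n≡0 𝟙[ u ≡ v ] v-unused
    where
    δ : V → ℕ
    δ = codeDegree S (u ∷ w)
    v : V
    v = leastLeaf S δ
    v-leaf : NonRoot S v × δ v ≡ 1
    v-leaf = let _ , Sj , δj = code-has-leaf (u ∷ w) cnt ends in leastLeaf-spec S δ Sj δj
    Sv : NonRoot S v
    Sv = proj₁ v-leaf
    v-unused : 𝟙[ u ≡ v ] + load w v ≡ 0
    v-unused = trans (sym (load-∷ u w v))
      (ℕ.+-cancelʳ-≡ 1 _ 0 (trans (cong (λ b → load (u ∷ w) v + 𝟙[¬ b ]) (sym Sv)) (proj₂ v-leaf)))
    u≢v : u ≢ v
    u≢v u≡v = ℕ.1+n≢0 (trans (cong (_+ load w v) (sym (trans (cong 𝟙[_≡ v ] u≡v) (𝟙-refl v)))) v-unused)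

  encode-correct : ∀ K S G → HasCount (NonRoot S) K → IsRootedForest S G
    → EndsInRoot S (encode K S G) × decode K S (encode K S G) ≡ G
      × (∀ j → codeDegree S (encode K S G) j ≡ deg G j)
  encode-correct zero S G cnt F = tt , sym G≡∅ , degrees
    where
    all-roots : ∀ j → S j ≡ true
    all-roots = noNonRoots⇒allRoots cnt
    G≡∅ : G ≡ emptyGraph
    G≡∅ = allRoots⇒empty F all-roots
    degrees : ∀ j → codeDegree S [] j ≡ deg G j
    degrees j = trans (codeDegree-[] all-roots j) (sym (trans (cong (λ H → deg H j) G≡∅) (deg-empty j)))
  encode-correct (suc K) S G cnt F = ends , decodes , degrees
    where
    v u : V
    v = leastLeaf S (deg G)
    u = neighbour G v
    Sv : NonRoot S v
    Sv = proj₁ (forest-leastLeaf cnt F)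
    leaf : IsLeafEdge G v u
    leaf = proj₂ (forest-leastLeaf cnt F)
    u≢v : u ≢ v
    u≢v = leaf-irreflexive F leaf
    S⁺ : V → Bool
    S⁺ = addRoot S v
    G⁻ : Graph n
    G⁻ = removeEdge G v u
    cnt⁻ : HasCount (NonRoot S⁺) K
    cnt⁻ = HasCount-addRoot cnt Sv
    w : Vec V K
    w = encode K S⁺ G⁻
    IH : EndsInRoot S⁺ w × decode K S⁺ w ≡ G⁻ × (∀ j → codeDegree S⁺ w j ≡ deg G⁻ j)
    IH = encode-correct K S⁺ G⁻ cnt⁻ (removeLeaf-rootedForest F Sv leaf)
    open ≡-Reasoning

    degrees : ∀ j → codeDegree S (u ∷ w) j ≡ deg G j
    degrees j = begin
      codeDegree S (u ∷ w) j                   ≡⟨ codeDegree-∷ S u w Sv j ⟩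
      𝟙[ u ≡ j ] + 𝟙[ v ≡ j ] + codeDegree S⁺ w j ≡⟨ cong (𝟙[ u ≡ j ] + 𝟙[ v ≡ j ] +_) (proj₂ (proj₂ IH) j) ⟩
      𝟙[ u ≡ j ] + 𝟙[ v ≡ j ] + deg G⁻ j        ≡⟨ deg-removeEdge G (symmetric F) (proj₁ leaf) u≢v j ⟨
      deg G j                                  ∎

    decodes : decode (suc K) S (u ∷ w) ≡ G
    decodes = begin
      decode (suc K) S (u ∷ w)   ≡⟨ cong (λ x → addEdge (decode K (addRoot S x) w) x u) (leastLeaf-cong S degrees) ⟩
      addEdge (decode K S⁺ w) v u ≡⟨ cong (λ H → addEdge H v u) (proj₁ (proj₂ IH)) ⟩
      addEdge G⁻ v u              ≡⟨ addEdge-removeEdge G (symmetric F) (proj₁ leaf) ⟩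
      G                          ∎

    ends : EndsInRoot S (u ∷ w)
    ends = endsInRoot-∷ w cnt⁻ (proj₁ IH) v-unused u≢v
      where
      v-unused : load w v ≡ 0
      v-unused = begin
        load w v           ≡⟨ root⇒codeDegree≡load S⁺ v w (addRoot-new S v) ⟨
        codeDegree S⁺ w v  ≡⟨ proj₂ (proj₂ IH) v ⟩
        deg G⁻ v           ≡⟨ isolated⇒deg≡0 G⁻ v (removeEdge-leaf-isolated G v u leaf) ⟩
        0                  ∎

  decode-correct : ∀ K S w → HasCount (NonRoot S) K → EndsInRoot S w
    → IsRootedForest S (decode K S w) × encode K S (decode K S w) ≡ w
      × (∀ j → deg (decode K S w) j ≡ codeDegree S w j)
  decode-correct zero S [] cnt _ = emptyGraph-rootedForest all-roots , refl , degrees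
    where
    all-roots : ∀ j → S j ≡ true
    all-roots = noNonRoots⇒allRoots cnt
    degrees : ∀ j → deg emptyGraph j ≡ codeDegree S [] j
    degrees j = trans (deg-empty j) (sym (codeDegree-[] all-roots j))
  decode-correct (suc K) S (u ∷ w) cnt ends = F , encodes , degrees
    where
    open ≡-Reasoning
    δ : V → ℕ
    δ = codeDegree S (u ∷ w)
    v : V
    v = leastLeaf S δ
    Sv : NonRoot S v
    Sv = proj₁ (code-leastLeaf u w cnt ends)
    u≢v : u ≢ v
    u≢v = proj₁ (proj₂ (code-leastLeaf u w cnt ends))
    S⁺ : V → Bool
    S⁺ = addRoot S v
    G′ : Graph n
    G′ = decode K S⁺ w
    IH : IsRootedForest S⁺ G′ × encode K S⁺ G′ ≡ w × (∀ j → deg G′ j ≡ codeDegree S⁺ w j)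
    IH = decode-correct K S⁺ w (HasCount-addRoot cnt Sv) (endsInRoot-tail S v w ends)
    F′ : IsRootedForest S⁺ G′
    F′ = proj₁ IH
    v-isolated : Isolated G′ v
    v-isolated = deg≡0⇒isolated G′ v (begin
      deg G′ v           ≡⟨ proj₂ (proj₂ IH) v ⟩
      codeDegree S⁺ w v  ≡⟨ root⇒codeDegree≡load S⁺ v w (addRoot-new S v) ⟩
      load w v           ≡⟨ proj₂ (proj₂ (code-leastLeaf u w cnt ends)) ⟩
      0                  ∎)
    G : Graph n
    G = addEdge G′ v u
    leaf : IsLeafEdge G v u
    leaf = addEdge-isolated-leaf G′ v u v-isolated u≢v
    F : IsRootedForest S G
    F = addLeaf-rootedForest F′ v-isolated u≢v Sv

    degrees : ∀ j → deg G j ≡ δ j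
    degrees j = begin
      deg G j                                   ≡⟨ deg-addLeaf G′ (symmetric F′) u v-isolated u≢v j ⟩
      𝟙[ u ≡ j ] + 𝟙[ v ≡ j ] + deg G′ j          ≡⟨ cong (𝟙[ u ≡ j ] + 𝟙[ v ≡ j ] +_) (proj₂ (proj₂ IH) j) ⟩
      𝟙[ u ≡ j ] + 𝟙[ v ≡ j ] + codeDegree S⁺ w j ≡⟨ codeDegree-∷ S u w Sv j ⟨
      δ j                                       ∎

    encodes : encode (suc K) S G ≡ u ∷ w
    encodes = begin
      encode (suc K) S G
        ≡⟨ cong (λ x → neighbour G x ∷ encode K (addRoot S x) (removeEdge G x (neighbour G x))) (leastLeaf-cong S degrees) ⟩
      neighbour G v ∷ encode K S⁺ (removeEdge G v (neighbour G v))
        ≡⟨ cong (λ y → y ∷ encode K S⁺ (removeEdge G v y)) (leaf⇒neighbour G v u leaf) ⟩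
      u ∷ encode K S⁺ (removeEdge G v u)
        ≡⟨ cong (λ H → u ∷ encode K S⁺ H) (removeEdge-addEdge G′ (symmetric F′) u v-isolated) ⟩
      u ∷ encode K S⁺ G′
        ≡⟨ cong (u ∷_) (proj₁ (proj₂ IH)) ⟩
      u ∷ w
        ∎

-- Forests rooted at the first t vertices

module FirstRoots (n′ t′ : ℕ) (t<n : suc t′ < suc n′) where
  open Forests n′
  open IsRootedForest

  t : ℕ
  t = suc t′

  t≤n : t ≤ n
  t≤n = ℕ.<⇒≤ t<n

  m : ℕ
  m = n ∸ t ∸ 1

  isRoot : V → Bool
  isRoot j = toℕ j <ᵇ t

  isRoot⇒< : ∀ {x} → isRoot x ≡ true → toℕ x < t
  isRoot⇒< {x} e = ℕ.<ᵇ⇒< (toℕ x) t (Equivalence.from Bool.T-≡ e)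

  <⇒isRoot : ∀ {x} → toℕ x < t → isRoot x ≡ true
  <⇒isRoot x<t = Equivalence.to Bool.T-≡ (ℕ.<⇒<ᵇ x<t)

  inject : Fin t → V
  inject r = inject≤ r t≤n

  toℕ-inject : ∀ r → toℕ (inject r) ≡ toℕ r
  toℕ-inject r = Fin.toℕ-inject≤ r t≤n

  isRoot-inject : ∀ r → isRoot (inject r) ≡ true
  isRoot-inject r = <⇒isRoot (subst (_< t) (sym (toℕ-inject r)) (Fin.toℕ<n r))

  project : V → Fin t
  project x with toℕ x ℕ.<? t
  ... | yes x<t = fromℕ< x<t
  ... | no _ = zero

  project-inject : ∀ r → project (inject r) ≡ r
  project-inject r with toℕ (inject r) ℕ.<? t
  ... | yes x<t = Fin.toℕ-injective (trans (Fin.toℕ-fromℕ< x<t) (toℕ-inject r))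
  ... | no x≮t = ⊥-elim (x≮t (isRoot⇒< (isRoot-inject r)))

  inject-project : ∀ {x} → isRoot x ≡ true → inject (project x) ≡ x
  inject-project {x} Sx with toℕ x ℕ.<? t
  ... | yes x<t = Fin.toℕ-injective (trans (toℕ-inject _) (Fin.toℕ-fromℕ< x<t))
  ... | no x≮t = ⊥-elim (x≮t (isRoot⇒< Sx))

  nonRoots : HasCount (NonRoot isRoot) (suc m)
  nonRoots = List.tabulate shift , length-shifts , tabulate⁺ shift-injective , λ j → mk⇔ (into j) (out j)
    where
    t+[n∸t]≡n : t + (n ∸ t) ≡ n
    t+[n∸t]≡n = ℕ.m+[n∸m]≡n t≤n
    shift : Fin (n ∸ t) → V
    shift i = cast t+[n∸t]≡n (t ↑ʳ i)
    toℕ-shift : ∀ i → toℕ (shift i) ≡ t + toℕ i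
    toℕ-shift i = trans (Fin.toℕ-cast t+[n∸t]≡n (t ↑ʳ i)) (Fin.toℕ-↑ʳ t i)
    length-shifts : length (List.tabulate shift) ≡ suc m
    length-shifts = trans (length-tabulate shift)
      (sym (trans (+-comm 1 m) (ℕ.m∸n+n≡m (ℕ.m<n⇒0<n∸m t<n))))
    shift-injective : ∀ {i j} → shift i ≡ shift j → i ≡ j
    shift-injective {i} {j} e =
      Fin.toℕ-injective (ℕ.+-cancelˡ-≡ t _ _ (trans (sym (toℕ-shift i)) (trans (cong toℕ e) (toℕ-shift j))))
    into : ∀ j → NonRoot isRoot j → j ∈ List.tabulate shift
    into j Sj = subst (_∈ List.tabulate shift) shift-i≡j (∈-tabulate⁺ i)
      where
      t≤j : t ≤ toℕ j
      t≤j = ℕ.≮⇒≥ (λ j<t → true≢false (trans (sym (<⇒isRoot j<t)) Sj))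
      i : Fin (n ∸ t)
      i = fromℕ< (ℕ.∸-monoˡ-< (Fin.toℕ<n j) t≤j)
      shift-i≡j : shift i ≡ j
      shift-i≡j = Fin.toℕ-injective (trans (toℕ-shift i) (trans (cong (t +_) (Fin.toℕ-fromℕ< _)) (ℕ.m+[n∸m]≡n t≤j)))
    out : ∀ j → j ∈ List.tabulate shift → NonRoot isRoot j
    out j j∈ with ∈-tabulate⁻ j∈
    ... | i , refl = Bool.¬-not (λ Sj → ℕ.<-irrefl refl
                       (ℕ.<-≤-trans (isRoot⇒< Sj) (subst (t ≤_) (sym (toℕ-shift i)) (ℕ.m≤m+n t (toℕ i)))))

  Code : Set
  Code = Vec V m × Fin t

  toWord : Code → Vec V (suc m)
  toWord (c , r) = c Vec.∷ʳ inject r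

  fromWord : Vec V (suc m) → Code
  fromWord w = init w , project (last w)

  fromWord-toWord : ∀ p → fromWord (toWord p) ≡ p
  fromWord-toWord (c , r) =
    cong₂ _,_ (init-∷ʳ (inject r) c) (trans (cong project (last-∷ʳ (inject r) c)) (project-inject r))

  toWord-fromWord : ∀ w → EndsInRoot isRoot w → toWord (fromWord w) ≡ w
  toWord-fromWord w@(_ ∷ _) ends =
    trans (cong (init w Vec.∷ʳ_) (inject-project ends)) (sym (proj₂ (proj₂ (initLast w))))

  toWord-endsInRoot : ∀ p → EndsInRoot isRoot (toWord p)
  toWord-endsInRoot (c , r) = endsInRoot-∷ʳ isRoot c (isRoot-inject r)

  weight : Code → Vec ℕ n
  weight (c , r) = ballVec c r

  𝟙-inject : ∀ r j → (toℕ r ≡ᵇ toℕ j) ≡ ⌊ inject r ≟ j ⌋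
  𝟙-inject r j = trans (does-⇔ same-index (toℕ r ℕ.≟ toℕ j) (inject r ≟ j)) (sym (isYes≗does (inject r ≟ j)))
    where
    same-index : toℕ r ≡ toℕ j ⇔ inject r ≡ j
    same-index = mk⇔ (λ e → Fin.toℕ-injective (trans (toℕ-inject r) e))
                     (λ e → trans (sym (toℕ-inject r)) (cong toℕ e))

  weight≡codeDegree : ∀ p → weight p ≡ tabulate (codeDegree isRoot (toWord p))
  weight≡codeDegree (c , r) = tabulate-cong bin
    where
    bin : ∀ j → (if toℕ j <ᵇ t then load c j + (if toℕ r ≡ᵇ toℕ j then 1 else 0) else load c j + 1)
                ≡ load (c Vec.∷ʳ inject r) j + isNonRoot isRoot j
    bin j rewrite load-∷ʳ c (inject r) j with toℕ j <ᵇ t in j<t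
    ... | true = trans (cong (λ b → load c j + (if b then 1 else 0)) (𝟙-inject r j)) (sym (+-identityʳ _))
    ... | false = trans (cong (_+ 1) (sym (+-identityʳ (load c j)))) (cong (λ k → load c j + k + 1) (sym (𝟙-≢ r≢j)))
      where
      r≢j : inject r ≢ j
      r≢j refl = true≢false (trans (sym (isRoot-inject r)) j<t)

  rootedForest⇒InF : ∀ {G} → IsRootedForest isRoot G → InF n t G
  rootedForest⇒InF {G} F = ((symmetric F , loopless F) , acyclic F) , (component , surjective , fibres) , separated
    where
    component : V → Fin t
    component x = project (root F x)
    root-of-root : ∀ r → root F (inject r) ≡ inject r
    root-of-root r = sym (roots-disconnected F _ _ (isRoot-inject r) (root-isRoot F _) (walk-to-root F (inject r)))
    surjective : ∀ r → ∃ λ x → ∀ {z} → z ≡ x → component z ≡ r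
    surjective r = inject r , λ { refl → trans (cong project (root-of-root r)) (project-inject r) }
    fibres : ∀ x y → (component x ≡ component y) ⇔ Connected G x y
    fibres x y = mk⇔ into out
      where
      into : component x ≡ component y → Connected G x y
      into e = walk-++ (walk-to-root F x) (subst (λ z → Walk G z y) (sym same-root)
                 (walk-reverse (symmetric F) (walk-to-root F y)))
        where
        same-root : root F x ≡ root F y
        same-root = trans (sym (inject-project (root-isRoot F x)))
                      (trans (cong inject e) (inject-project (root-isRoot F y)))
      out : Connected G x y → component x ≡ component y
      out w = cong project (roots-disconnected F _ _ (root-isRoot F x) (root-isRoot F y)
        (walk-++ (walk-reverse (symmetric F) (walk-to-root F x)) (walk-++ w (walk-to-root F y))))
    separated : ∀ x y → toℕ x < t → toℕ y < t → x ≢ y → ¬ Connected G x y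
    separated x y x<t y<t x≢y w = x≢y (roots-disconnected F x y (<⇒isRoot x<t) (<⇒isRoot y<t) w)

  InF⇒rootedForest : ∀ {G} → InF n t G → IsRootedForest isRoot G
  InF⇒rootedForest {G} (((G-sym , G-loopless) , G-acyclic) , (component , _ , fibres) , separated) = record
    { symmetric = G-sym
    ; loopless = G-loopless
    ; acyclic = G-acyclic
    ; root = λ x → inject (root-index x)
    ; root-isRoot = λ x → isRoot-inject (root-index x)
    ; walk-to-root = λ x → Equivalence.to (fibres x _) (sym (proj₂ (root-component-onto (component x))))
    ; roots-disconnected = disconnected
    }
    where
    disconnected : ∀ r r′ → isRoot r ≡ true → isRoot r′ ≡ true → Walk G r r′ → r ≡ r′
    disconnected r r′ Sr Sr′ w with r ≟ r′
    ... | yes r≡r′ = r≡r′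
    ... | no r≢r′ = ⊥-elim (separated r r′ (isRoot⇒< Sr) (isRoot⇒< Sr′) r≢r′ w)
    root-component : Fin t → Fin t
    root-component i = component (inject i)
    root-component-injective : ∀ {i j} → root-component i ≡ root-component j → i ≡ j
    root-component-injective {i} {j} e =
      trans (sym (project-inject i)) (trans (cong project inject-i≡inject-j) (project-inject j))
      where
      inject-i≡inject-j : inject i ≡ inject j
      inject-i≡inject-j = disconnected _ _ (isRoot-inject i) (isRoot-inject j) (Equivalence.to (fibres _ _) e)
    root-component-onto : ∀ y → Σ (Fin t) λ i → root-component i ≡ y
    root-component-onto = Fin-injective⇒surjective root-component root-component-injective
    root-index : V → Fin t
    root-index x = proj₁ (root-component-onto (component x))

  encodeCode : Graph n → Code
  encodeCode G = fromWord (encode (suc m) isRoot G)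

  decodeCode : Code → Graph n
  decodeCode p = decode (suc m) isRoot (toWord p)

  module _ {G : Graph n} (inF : InF n t G) where
    private
      w : Vec V (suc m)
      w = encode (suc m) isRoot G

      correct : EndsInRoot isRoot w × decode (suc m) isRoot w ≡ G × (∀ j → codeDegree isRoot w j ≡ deg G j)
      correct = encode-correct (suc m) isRoot G nonRoots (InF⇒rootedForest inF)

      toWord-encodeCode : toWord (encodeCode G) ≡ w
      toWord-encodeCode = toWord-fromWord w (proj₁ correct)

    decodeCode-encodeCode : decodeCode (encodeCode G) ≡ G
    decodeCode-encodeCode = trans (cong (decode (suc m) isRoot) toWord-encodeCode) (proj₁ (proj₂ correct))

    weight-encodeCode : weight (encodeCode G) ≡ degSeq G
    weight-encodeCode = begin
      weight (encodeCode G)                                ≡⟨ weight≡codeDegree (encodeCode G) ⟩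
      tabulate (codeDegree isRoot (toWord (encodeCode G))) ≡⟨ cong (tabulate ∘ codeDegree isRoot) toWord-encodeCode ⟩
      tabulate (codeDegree isRoot w)                       ≡⟨ tabulate-cong (proj₂ (proj₂ correct)) ⟩
      degSeq G                                             ∎
      where open ≡-Reasoning

  module _ (p : Code) where
    private
      correct : IsRootedForest isRoot (decodeCode p) × encode (suc m) isRoot (decodeCode p) ≡ toWord p
                × (∀ j → deg (decodeCode p) j ≡ codeDegree isRoot (toWord p) j)
      correct = decode-correct (suc m) isRoot (toWord p) nonRoots (toWord-endsInRoot p)

    decodeCode-InF : InF n t (decodeCode p)
    decodeCode-InF = rootedForest⇒InF (proj₁ correct)

    encodeCode-decodeCode : encodeCode (decodeCode p) ≡ p
    encodeCode-decodeCode = trans (cong fromWord (proj₁ (proj₂ correct))) (fromWord-toWord p)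

    degSeq-decodeCode : degSeq (decodeCode p) ≡ weight p
    degSeq-decodeCode = trans (tabulate-cong (proj₂ (proj₂ correct))) (sym (weight≡codeDegree p))

  prüfer : SubsetBijection (InF n t) (λ (_ : Code) → ⊤)
  prüfer = record
    { to = encodeCode
    ; from = decodeCode
    ; to-resp = λ _ → tt
    ; from-resp = λ {p} _ → decodeCode-InF p
    ; from∘to = decodeCode-encodeCode
    ; to∘from = λ {p} _ → encodeCode-decodeCode p
    }

  prüfer-degSeq : ∀ d → SubsetBijection (λ G → InF n t G × degSeq G ≡ d) (λ p → weight p ≡ d)
  prüfer-degSeq d = record
    { to = encodeCode
    ; from = decodeCode
    ; to-resp = λ (inF , G↦d) → trans (weight-encodeCode inF) G↦d
    ; from-resp = λ {p} p↦d → decodeCode-InF p , trans (degSeq-decodeCode p) p↦d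
    ; from∘to = λ (inF , _) → decodeCode-encodeCode inF
    ; to∘from = λ {p} _ → encodeCode-decodeCode p
    }

theorem6p2 : (n t : ℕ) → t < n → (d : Vec ℕ n)
    → (a b c : ℕ)
    → HasCount (InF n t) a
    → HasCount (λ G → InF n t G × degSeq G ≡ d) b
    → HasCount (λ (p : Vec (Fin n) (n ∸ t ∸ 1) × Fin t) → ballVec (proj₁ p) (proj₂ p) ≡ d) c
    → b * (n ^ (n ∸ t ∸ 1) * t) ≡ c * a
theorem6p2 (suc n′) zero _ d a b c _ _ no-codes
  rewrite HasCount-empty (λ ()) no-codes = trans (cong (b *_) (ℕ.*-zeroʳ (suc n′ ^ n′))) (ℕ.*-zeroʳ b)
theorem6p2 (suc n′) (suc t′) t<n d a b c forests forests-d codes-d = begin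
  b * (n ^ m * t)  ≡⟨ cong (_* (n ^ m * t)) b≡c ⟩
  c * (n ^ m * t)  ≡⟨ cong (c *_) a≡nᵐt ⟨
  c * a            ∎
  where
  open FirstRoots n′ t′ t<n
  open Forests n′ using (n)
  open ≡-Reasoning
  a≡nᵐt : a ≡ n ^ m * t
  a≡nᵐt = HasCount-unique (HasCount-transport prüfer forests) (HasCount-Vec×Fin n m t)
  b≡c : b ≡ c
  b≡c = HasCount-unique (HasCount-transport (prüfer-degSeq d) forests-d) codes-d
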